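{- Let $\mathcal{N}=(N,E)$ be a finite undirected graph and let $y,z\in N$ be nodes such that $y$ subsumes $z$, i.e. $\{z\}.\varphi\subseteq\{y\}.\varphi$. Let $x\in N$ and let $\sigma(x,y)$ be a shortest path between $x$ and $y$. If $z\in\sigma(x,y)$, then there exists a shortest path $\sigma'(x,y)$ between $x$ and $y$ such that $z\notin\sigma'(x,y)$.
   Context: For a set $Y\subseteq N$ of nodes, its neighborhood is $Y.\eta=\{z\notin Y : \exists y\in Y,\ (y,z)\in E\}$ and its region is $Y.\rho=Y\cup Y.\eta$. The neighborhood closure of $Y$ is $Y.\varphi=\{z\in Y.\rho : \{z\}.\rho\subseteq Y.\rho\}$. A node $z$ is subsumed by a node $y$ if $\{z\}.\varphi\subseteq\{y\}.\varphi$. -}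

module Defs where

open import Level using (0ℓ)
open import Data.Nat using (ℕ; zero; suc; _≤_)
open import Data.Fin using (Fin)
open import Data.Product using (_×_; ∃-syntax)
open import Data.Sum using (_⊎_)
open import Relation.Nullary using (¬_)
open import Relation.Binary.PropositionalEquality using (_≡_)
open import Relation.Unary using (Pred; _∈_; _∉_; _⊆_; _∪_; ｛_｝)

record Graph : Set₁ where
  field
    size : ℕ
    Edge : Fin size → Fin size → Set
    Edge-sym : ∀ {a b} → Edge a b → Edge b a

  Node : Set
  Node = Fin size

  NodeSet : Set₁
  NodeSet = Pred Node 0ℓ

  η : NodeSet → NodeSet
  η Y z = z ∉ Y × ∃[ y ] (y ∈ Y × Edge y z)

  ρ : NodeSet → NodeSet
  ρ Y = Y ∪ η Y

  φ : NodeSet → NodeSet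
  φ Y z = z ∈ ρ Y × ρ ｛ z ｝ ⊆ ρ Y

  _SubsumedBy_ : Node → Node → Set
  z SubsumedBy y = φ ｛ z ｝ ⊆ φ ｛ y ｝

  data Path : Node → Node → Set where
    [_]   : ∀ a → Path a a
    _∷⟨_⟩_ : ∀ a {b c} → Edge a b → Path b c → Path a c

  length : ∀ {a b} → Path a b → ℕ
  length [ _ ] = zero
  length (_ ∷⟨ _ ⟩ p) = suc (length p)

  _∈P_ : ∀ {a b} → Node → Path a b → Set
  z ∈P [ a ] = z ≡ a
  z ∈P (a ∷⟨ _ ⟩ p) = z ≡ a ⊎ z ∈P p

  IsShortest : ∀ {a b} → Path a b → Set
  IsShortest {a} {b} σ = ∀ (τ : Path a b) → length σ ≤ length τ

{-# OPTIONS --safe #-}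
-- Since z ∈ {z}.φ, subsumption gives {z}.ρ ⊆ {y}.ρ: every neighbour of z is y or
-- adjacent to y. So a path from x to y through z can leave its predecessor a of the
-- first occurrence of z straight for y, which costs at most the remaining length.
module Submission where

open import Defs
open import Data.Product using (Σ; _×_; _,_; proj₂)
open import Data.Sum using (_⊎_; inj₁; inj₂)
open import Data.Nat using (z≤n; s≤s; _≤_)
open import Data.Nat.Properties using (≤-trans)
open import Data.Fin using (_≟_)
open import Data.Empty using (⊥-elim)
open import Relation.Nullary using (¬_; yes; no)
open import Relation.Binary.PropositionalEquality using (_≢_; _≡_; refl; sym)
open import Relation.Unary using (_∈_; _⊆_; ｛_｝)

module _ (G : Graph) where
  open Graph G

  ∈-φ-｛｝ : ∀ z → z ∈ φ ｛ z ｝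
  ∈-φ-｛｝ z = inj₁ refl , λ a∈ρ → a∈ρ

  SubsumedBy⇒ρ⊆ρ : ∀ {y z} → z SubsumedBy y → ρ ｛ z ｝ ⊆ ρ ｛ y ｝
  SubsumedBy⇒ρ⊆ρ sub = proj₂ (sub (∈-φ-｛｝ _))

  SubsumedBy⇒neighbour : ∀ {y z a} → z SubsumedBy y → a ≢ z → Edge a z →
                         a ≡ y ⊎ Edge a y
  SubsumedBy⇒neighbour sub a≢z e
    with SubsumedBy⇒ρ⊆ρ sub (inj₂ ((λ z≡a → a≢z (sym z≡a)) , _ , refl , Edge-sym e))
  ... | inj₁ y≡a                 = inj₁ (sym y≡a)
  ... | inj₂ (_ , _ , refl , e′) = inj₂ (Edge-sym e′)

  ∉P-∷ : ∀ {z a b c} {e : Edge a b} {p : Path b c} →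
         z ≢ a → ¬ (z ∈P p) → ¬ (z ∈P (a ∷⟨ e ⟩ p))
  ∉P-∷ z≢a z∉p (inj₁ z≡a) = z≢a z≡a
  ∉P-∷ z≢a z∉p (inj₂ z∈p) = z∉p z∈p

  IsShortest-≤ : ∀ {a b} {σ σ′ : Path a b} → IsShortest σ → length σ′ ≤ length σ →
                 IsShortest σ′
  IsShortest-≤ σ-shortest σ′≤σ τ = ≤-trans σ′≤σ (σ-shortest τ)

  module _ {y z : Node} (sub : z SubsumedBy y) (z≢y : z ≢ y) where

    bypass : ∀ {a b} (p : Path a b) → z ∈P p → z ≢ a →
             Σ (Path a y) (λ q → length q ≤ length p × ¬ (z ∈P q))
    bypass [ a ] z≡a z≢a = ⊥-elim (z≢a z≡a)
    bypass (_∷⟨_⟩_ a {b} e p) _ z≢a with z ≟ b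
    ... | yes refl with SubsumedBy⇒neighbour sub (λ a≡z → z≢a (sym a≡z)) e
    ...   | inj₁ refl = [ y ] , z≤n , z≢a
    ...   | inj₂ e′   = a ∷⟨ e′ ⟩ [ y ] , s≤s z≤n , ∉P-∷ {e = e′} z≢a z≢y
    bypass (a ∷⟨ e ⟩ p) (inj₁ z≡a) z≢a | no _ = ⊥-elim (z≢a z≡a)
    bypass (a ∷⟨ e ⟩ p) (inj₂ z∈p) z≢a | no z≢b with bypass p z∈p z≢b
    ... | q , q≤p , z∉q = a ∷⟨ e ⟩ q , s≤s q≤p , ∉P-∷ {e = e} z≢a z∉q

proposition1 : (G : Graph) → let open Graph G in
    (x y z : Node) → z SubsumedBy y → z ≢ x → z ≢ y →
    (σ : Path x y) → IsShortest σ → z ∈P σ →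
    Σ (Path x y) (λ σ′ → IsShortest σ′ × ¬ (z ∈P σ′))
proposition1 G x y z sub z≢x z≢y σ σ-shortest z∈σ
  with bypass G sub z≢y σ z∈σ z≢x
... | σ′ , σ′≤σ , z∉σ′ = σ′ , IsShortest-≤ G σ-shortest σ′≤σ , z∉σ′
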